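{- For every bipartite multigraph $H$ with $\ell=|E(H)|$ edges and every integer $k \geq \ell$, we have $\pi_k^{\ast}(H) \leq \frac{\ell-1}{k}$.
   Context: All multigraphs have no loops (parallel edges allowed). A graph system of order $k$ on a vertex set $V$ is a tuple $\mathcal{G}=(G_1,\dots,G_k)$ of simple graphs on the common vertex set $V$. A multigraph $H$ with $V(H)\subseteq V$ is a rainbow subgraph of $\mathcal{G}$ if there is an injective map $\psi:E(H)\to[k]$ with $e\in E(G_{\psi(e)})$ for every $e\in E(H)$; $\mathcal{G}$ is rainbow $H$-free if it has no rainbow subgraph isomorphic to $H$. $\mathrm{ex}_k^{\ast}(n,H)$ is the maximum of $\min_{1\le i\le k}|E(G_i)|$ over rainbow $H$-free graph systems $(G_1,\dots,G_k)$ on $[n]$, and $\pi_k^{\ast}(H)=\lim_{n\to\infty}\mathrm{ex}_k^{\ast}(n,H)/\binom{n}{2}$ (this limit exists for $k\ge|E(H)|$). -}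

module Defs where

open import Data.Nat using (ℕ; zero; suc; _+_; _*_; _∸_; _≤_; _<ᵇ_)
open import Data.Fin using (Fin; toℕ)
open import Data.Bool using (Bool; true; false; if_then_else_; _∧_)
open import Data.List using (List; map; allFin)
open import Data.Nat.ListAction using (sum)
open import Data.Product using (_×_; _,_; proj₁; proj₂; Σ; ∃; ∃-syntax)
open import Relation.Binary.PropositionalEquality using (_≡_; _≢_)
open import Relation.Nullary using (¬_)
open import Function.Definitions using (Injective)

-- A (loopless) multigraph on vertex set Fin v with ℓ edges, given by the
-- endpoints of each edge; parallel edges are allowed (distinct edge indices
-- may have the same endpoints).
record Multigraph : Set where
  field
    nV   : ℕ
    nE   : ℕ
    ends : Fin nE → Fin nV × Fin nV
    loopless : ∀ e → proj₁ (ends e) ≢ proj₂ (ends e)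

open Multigraph public

Bipartite : Multigraph → Set
Bipartite H = Σ (Fin (nV H) → Bool) λ c → (∀ e → c (proj₁ (ends H e)) ≢ c (proj₂ (ends H e)))

Adj : ℕ → Set
Adj n = Fin n → Fin n → Bool

IsSimpleGraph : {n : ℕ} → Adj n → Set
IsSimpleGraph {n} A = (∀ x y → A x y ≡ A y x) × (∀ x → A x x ≡ false)

edgeCount : {n : ℕ} → Adj n → ℕ
edgeCount {n} A =
  sum (map (λ x → sum (map (λ y → if (toℕ x <ᵇ toℕ y) ∧ A x y then 1 else 0)
                           (allFin n)))
           (allFin n))

GraphSystem : ℕ → ℕ → Set
GraphSystem k n = Fin k → Adj n

IsGraphSystem : {k n : ℕ} → GraphSystem k n → Set
IsGraphSystem {k} G = ∀ (i : Fin k) → IsSimpleGraph (G i)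

RainbowCopy : (H : Multigraph) {k n : ℕ} → GraphSystem k n → Set
RainbowCopy H {k} {n} G =
  Σ (Fin (nV H) → Fin n) λ φ →
  Σ (Fin (nE H) → Fin k) λ ψ →
    Injective _≡_ _≡_ φ × Injective _≡_ _≡_ ψ ×
    (∀ e → G (ψ e) (φ (proj₁ (ends H e))) (φ (proj₂ (ends H e))) ≡ true)

RainbowFree : (H : Multigraph) {k n : ℕ} → GraphSystem k n → Set
RainbowFree H G = ¬ RainbowCopy H G

-- Suppose every colour class G_i has more than ((ℓ − 1)/k + 1/Q)·n(n − 1)/2 edges. A pair of vertices
-- lying in at most ℓ − 1 classes contributes at most ℓ − 1 to Σ_i e(G_i), so the rich pairs, lying in
-- at least ℓ classes, form a graph of density more than 1/Q. By a Kővári–Sós–Turán argument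
-- (repeatedly passing to the common neighbourhood of a well-chosen vertex) such a graph on many
-- vertices contains K_{s,s} with s = |V(H)|, into which the bipartite H embeds. Every edge of this
-- copy is rich, so the ℓ edges of H can be given distinct colours greedily: a rainbow copy of H.
module Submission where

open import Defs
open import Data.Bool using (Bool; true; false; _∧_; _∨_; not; if_then_else_)
open import Data.Bool.Properties using (∧-conicalˡ; ∧-conicalʳ; ∨-conicalʳ)
open import Data.Fin using (Fin; zero; suc)
open import Data.Fin.Properties using (_≟_; _<?_; <-cmp; <-irrefl; any?)
open import Data.List using (tabulate) renaming (map to mapList)
open import Data.Nat using (ℕ; zero; suc; _+_; _*_; _∸_; _^_; _≤_; _<_; z≤n; s≤s; NonZero; _≤?_;
                            >-nonZero; >-nonZero⁻¹; ≢-nonZero)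
open import Data.Nat.DivMod using (_/_; _%_; m/n*n≤m; m%n<n; m≡m%n+[m/n]*n)
open import Data.Nat.ListAction using () renaming (sum to sumList)
open import Data.Nat.Properties hiding (_≟_; _<?_; <-cmp; <-irrefl)
open import Data.Nat.Tactic.RingSolver using (solve-∀)
open import Data.Product using (Σ; ∃-syntax; _×_; _,_; proj₁; proj₂; map)
open import Data.Vec.Functional using ([]; _∷_)
open import Function using (_∘_; id)
open import Function.Definitions using (Injective)
open import Relation.Binary using (tri<; tri≈; tri>)
open import Relation.Binary.PropositionalEquality
open import Relation.Nullary using (Dec; does; yes; no; contradiction)
open import Relation.Nullary.Decidable using (⌊_⌋; dec-true; dec-false; isYes≗does; decidable-stable)
open import Algebra.Properties.Semiring.Sum +-*-semiring
  using (sum; sum-syntax; sum-cong-≗; ∑-distrib-+; ∑-comm; *-distribˡ-sum; *-distribʳ-sum)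

⟦_⟧ : Bool → ℕ
⟦ b ⟧ = if b then 1 else 0

⟦⟧≤1 : ∀ b → ⟦ b ⟧ ≤ 1
⟦⟧≤1 true  = ≤-refl
⟦⟧≤1 false = z≤n

⟦∧⟧≤ : ∀ a b → ⟦ a ∧ b ⟧ ≤ ⟦ a ⟧
⟦∧⟧≤ true  b = ⟦⟧≤1 b
⟦∧⟧≤ false b = z≤n

⟦∨⟧≤ : ∀ a b → ⟦ a ∨ b ⟧ ≤ ⟦ a ⟧ + ⟦ b ⟧
⟦∨⟧≤ true  b = s≤s z≤n
⟦∨⟧≤ false b = ≤-refl

⟦not⟧+⟦⟧ : ∀ b → ⟦ not b ⟧ + ⟦ b ⟧ ≡ 1
⟦not⟧+⟦⟧ true  = refl
⟦not⟧+⟦⟧ false = refl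

⌊⌋≡true⇒ : ∀ {a} {A : Set a} (a? : Dec A) → ⌊ a? ⌋ ≡ true → A
⌊⌋≡true⇒ (yes a) _ = a

sum-mono-≤ : ∀ {n} {f g : Fin n → ℕ} → (∀ i → f i ≤ g i) → sum f ≤ sum g
sum-mono-≤ {zero}  f≤g = z≤n
sum-mono-≤ {suc n} f≤g = +-mono-≤ (f≤g zero) (sum-mono-≤ (f≤g ∘ suc))

sum-const : ∀ n c → ∑[ i < n ] c ≡ n * c
sum-const zero    c = refl
sum-const (suc n) c = cong (c +_) (sum-const n c)

∑-linear : ∀ {n} a b (f g : Fin n → ℕ) → ∑[ i < n ] (a * f i + b * g i) ≡ a * sum f + b * sum g
∑-linear {n} a b f g =
  trans (∑-distrib-+ {n} _ _) (sym (cong₂ _+_ (*-distribˡ-sum {n} a f) (*-distribˡ-sum {n} b g)))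

sum-map-tabulate : ∀ {a} {A : Set a} {n} (f : A → ℕ) (g : Fin n → A) →
                   sumList (mapList f (tabulate g)) ≡ ∑[ i < n ] f (g i)
sum-map-tabulate {n = zero}  f g = refl
sum-map-tabulate {n = suc n} f g = cong (f (g zero) +_) (sum-map-tabulate f (g ∘ suc))

∃-≥-average : ∀ {n} .{{_ : NonZero n}} (f : Fin n → ℕ) → ∃[ z ] sum f ≤ n * f z
∃-≥-average {suc zero}    f = zero , ≤-refl
∃-≥-average {suc (suc n)} f with ∃-≥-average (f ∘ suc)
... | z , avg with f zero ≤? f (suc z)
...   | yes f₀≤ = suc z , +-mono-≤ f₀≤ avg
...   | no f₀≰  = zero , +-monoʳ-≤ (f zero) (≤-trans avg (*-monoʳ-≤ (suc n) (≰⇒≥ f₀≰)))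

count : ∀ {n} → (Fin n → Bool) → ℕ
count {n} P = ∑[ x < n ] ⟦ P x ⟧

count≤size : ∀ {n} (P : Fin n → Bool) → count P ≤ n
count≤size {n} P = ≤-trans (sum-mono-≤ (⟦⟧≤1 ∘ P)) (≤-reflexive (trans (sum-const n 1) (*-identityʳ n)))

count-singleton : ∀ {n} (x : Fin n) → count (λ y → ⌊ x ≟ y ⌋) ≡ 1
count-singleton {suc n} zero    = cong suc (trans (sum-const n 0) (*-zeroʳ n))
count-singleton {suc n} (suc x) = trans (sum-cong-≗ shift) (count-singleton x)
  where
  shift : ∀ y → ⟦ ⌊ suc x ≟ suc y ⌋ ⟧ ≡ ⟦ ⌊ x ≟ y ⌋ ⟧
  shift y with x ≟ y
  ... | yes _ = refl
  ... | no _  = refl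

count-∨ : ∀ {n} (P Q : Fin n → Bool) → count (λ x → P x ∨ Q x) ≤ count P + count Q
count-∨ P Q =
  ≤-trans (sum-mono-≤ (λ x → ⟦∨⟧≤ (P x) (Q x))) (≤-reflexive (∑-distrib-+ (⟦_⟧ ∘ P) (⟦_⟧ ∘ Q)))

count-not+count : ∀ {n} (P : Fin n → Bool) → count (not ∘ P) + count P ≡ n
count-not+count {n} P = begin
  count (not ∘ P) + count P            ≡⟨ ∑-distrib-+ {n} (⟦_⟧ ∘ not ∘ P) (⟦_⟧ ∘ P) ⟨
  ∑[ x < n ] (⟦ not (P x) ⟧ + ⟦ P x ⟧) ≡⟨ sum-cong-≗ (⟦not⟧+⟦⟧ ∘ P) ⟩
  ∑[ x < n ] 1                         ≡⟨ sum-const n 1 ⟩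
  n * 1                                ≡⟨ *-identityʳ n ⟩
  n                                    ∎
  where open ≡-Reasoning

count<⇒∃ : ∀ {n} (P M : Fin n → Bool) → count M < count P → ∃[ c ] (P c ≡ true × M c ≡ false)
count<⇒∃ {suc n} P M M<P with P zero in P₀ | M zero in M₀
... | true  | false = zero , P₀ , M₀
... | true  | true  = map suc id (count<⇒∃ (P ∘ suc) (M ∘ suc) (≤-pred M<P))
... | false | false = map suc id (count<⇒∃ (P ∘ suc) (M ∘ suc) M<P)
... | false | true  = map suc id (count<⇒∃ (P ∘ suc) (M ∘ suc) (≤-trans (n≤1+n _) M<P))

sum≤masked : ∀ {n} (c : Fin n → ℕ) (M : Fin n → Bool) {w} → (∀ z → c z ≤ w) →
             sum c ≤ ∑[ z < n ] (if M z then 0 else c z) + w * count M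
sum≤masked {n} c M {w} c≤w = begin
  sum c                                                          ≤⟨ sum-mono-≤ split ⟩
  ∑[ z < n ] ((if M z then 0 else c z) + w * ⟦ M z ⟧)            ≡⟨ ∑-distrib-+ {n} _ _ ⟩
  ∑[ z < n ] (if M z then 0 else c z) + ∑[ z < n ] (w * ⟦ M z ⟧) ≡⟨ cong (_ +_) (*-distribˡ-sum {n} w _) ⟨
  ∑[ z < n ] (if M z then 0 else c z) + w * count M              ∎
  where
  open ≤-Reasoning
  split : ∀ z → c z ≤ (if M z then 0 else c z) + w * ⟦ M z ⟧
  split z with M z
  ... | true  = ≤-trans (c≤w z) (≤-reflexive (sym (*-identityʳ w)))
  ... | false = m≤m+n (c z) (w * 0)

∃-heavy-outside : ∀ {n} .{{_ : NonZero n}} (c : Fin n → ℕ) (M : Fin n → Bool) {w} →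
                  (∀ z → c z ≤ w) → w * count M < sum c →
                  ∃[ z ] (M z ≡ false × sum c ≤ n * c z + w * count M)
∃-heavy-outside {n} c M {w} c≤w light
  with z , avg ← ∃-≥-average (λ z → if M z then 0 else c z)
  with M z in Mz | ≤-trans (sum≤masked c M c≤w) (+-monoˡ-≤ (w * count M) avg)
... | true  | bound = contradiction (subst (λ t → sum c ≤ t + w * count M) (*-zeroʳ n) bound) (<⇒≱ light)
... | false | bound = z , Mz , bound

inImage : ∀ {j n} → (Fin j → Fin n) → Fin n → Bool
inImage {zero}  Y w = false
inImage {suc j} Y w = ⌊ Y zero ≟ w ⌋ ∨ inImage (Y ∘ suc) w

count-inImage≤ : ∀ {j n} (Y : Fin j → Fin n) → count (inImage Y) ≤ j
count-inImage≤ {zero}  {n} Y = ≤-reflexive (trans (sum-const n 0) (*-zeroʳ n))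
count-inImage≤ {suc j}     Y = begin
  count (inImage Y)                           ≤⟨ count-∨ (λ w → ⌊ Y zero ≟ w ⌋) (inImage (Y ∘ suc)) ⟩
  count (λ w → ⌊ Y zero ≟ w ⌋) + count rest   ≡⟨ cong (_+ count rest) (count-singleton (Y zero)) ⟩
  suc (count rest)                            ≤⟨ s≤s (count-inImage≤ (Y ∘ suc)) ⟩
  suc j                                       ∎
  where
  open ≤-Reasoning
  rest : Fin _ → Bool
  rest = inImage (Y ∘ suc)

∉-image : ∀ {j n} (Y : Fin j → Fin n) {w} → inImage Y w ≡ false → ∀ i → Y i ≢ w
∉-image Y {w} w∉ zero Y₀≡w with Y zero ≟ w
... | yes _    = contradiction w∉ λ ()
... | no Y₀≢w = Y₀≢w Y₀≡w
∉-image Y w∉ (suc i) = ∉-image (Y ∘ suc) (∨-conicalʳ _ _ w∉) i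

∷-injective : ∀ {j n} {Y : Fin j → Fin n} {z} → Injective _≡_ _≡_ Y → inImage Y z ≡ false →
              Injective _≡_ _≡_ (z ∷ Y)
∷-injective             Y-inj z∉ {zero}  {zero}  _     = refl
∷-injective {Y = Y}     Y-inj z∉ {zero}  {suc j} z≡Yj  = contradiction (sym z≡Yj) (∉-image Y z∉ j)
∷-injective {Y = Y}     Y-inj z∉ {suc i} {zero}  Yi≡z  = contradiction Yi≡z (∉-image Y z∉ i)
∷-injective             Y-inj z∉ {suc i} {suc j} Yi≡Yj = cong suc (Y-inj Yi≡Yj)

injective-choice : ∀ {j k} (P : Fin j → Fin k → Bool) → (∀ e → j ≤ count (P e)) →
                   Σ (Fin j → Fin k) λ ψ → Injective _≡_ _≡_ ψ × (∀ e → P e (ψ e) ≡ true)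
injective-choice {zero} P large = (λ ()) , (λ { {()} }) , λ ()
injective-choice {suc j} P large
  with ψ , ψ-inj , ψ-ok ← injective-choice (P ∘ suc) (λ e → ≤-trans (n≤1+n j) (large (suc e)))
  with c , Pc , c∉ ← count<⇒∃ (P zero) (inImage ψ) (≤-trans (s≤s (count-inImage≤ ψ)) (large zero))
  = c ∷ ψ , ∷-injective ψ-inj c∉ , λ { zero → Pc ; (suc e) → ψ-ok e }

degree : ∀ {n} → Adj n → Fin n → ℕ
degree R x = count (R x)

degreeSum : ∀ {n} → Adj n → ℕ
degreeSum {n} R = ∑[ x < n ] degree R x

highDegree : ∀ {n} → Adj n → ℕ → Fin n → Bool
highDegree R b x = ⌊ b ≤? degree R x ⌋

completeGraph : ∀ {n} → Adj n
completeGraph x y = not ⌊ x ≟ y ⌋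

degreeSum-completeGraph : ∀ n → degreeSum (completeGraph {n}) ≡ n * (n ∸ 1)
degreeSum-completeGraph n = trans (sum-cong-≗ {n} row) (sum-const n (n ∸ 1))
  where
  row : ∀ x → degree (completeGraph {n}) x ≡ n ∸ 1
  row x = begin
    degree completeGraph x                               ≡⟨ m+n∸n≡m _ 1 ⟨
    degree completeGraph x + 1 ∸ 1
      ≡⟨ cong (λ c → degree completeGraph x + c ∸ 1) (count-singleton x) ⟨
    degree completeGraph x + count (λ y → ⌊ x ≟ y ⌋) ∸ 1
      ≡⟨ cong (_∸ 1) (count-not+count (λ y → ⌊ x ≟ y ⌋)) ⟩
    n ∸ 1                                                ∎
    where open ≡-Reasoning

-- does (x <? y) computes to the test toℕ x <ᵇ toℕ y of Defs, whereas ⌊ x <? y ⌋ would not.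
edgeCount≡ : ∀ {n} (A : Adj n) → edgeCount A ≡ ∑[ x < n ] count (λ y → does (x <? y) ∧ A x y)
edgeCount≡ {n} A = trans (sum-map-tabulate {n = n} _ id) (sum-cong-≗ {n} λ x → sum-map-tabulate {n = n} _ id)

split-by-order : ∀ {n} (A : Adj n) → (∀ x → A x x ≡ false) → ∀ x y →
                 ⟦ A x y ⟧ ≡ ⟦ does (x <? y) ∧ A x y ⟧ + ⟦ does (y <? x) ∧ A x y ⟧
split-by-order A irr x y with <-cmp x y
... | tri< x<y _ y≮x rewrite dec-true (x <? y) x<y | dec-false (y <? x) y≮x = sym (+-identityʳ _)
... | tri> x≮y _ y<x rewrite dec-false (x <? y) x≮y | dec-true (y <? x) y<x = refl
... | tri≈ _ refl _  rewrite dec-false (x <? x) (<-irrefl refl) | irr x     = refl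

handshake : ∀ {n} (A : Adj n) → IsSimpleGraph A → degreeSum A ≡ 2 * edgeCount A
handshake {n} A (A-sym , A-irr) = begin
  degreeSum A
    ≡⟨ sum-cong-≗ (λ x → trans (sum-cong-≗ (split-by-order A A-irr x)) (∑-distrib-+ {n} _ _)) ⟩
  ∑[ x < n ] (count (λ y → does (x <? y) ∧ A x y) + count (λ y → does (y <? x) ∧ A x y))
    ≡⟨ ∑-distrib-+ {n} _ _ ⟩
  E + ∑[ x < n ] count (λ y → does (y <? x) ∧ A x y)
    ≡⟨ cong (E +_) (∑-comm {n} {n} _) ⟩
  E + ∑[ y < n ] count (λ x → does (y <? x) ∧ A x y)
    ≡⟨ cong (E +_) (sum-cong-≗ λ y → sum-cong-≗ λ x → cong (λ a → ⟦ does (y <? x) ∧ a ⟧) (A-sym x y)) ⟩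
  E + E
    ≡⟨ cong (E +_) (sym (+-identityʳ E)) ⟩
  2 * E
    ≡⟨ cong (2 *_) (edgeCount≡ A) ⟨
  2 * edgeCount A ∎
  where
  open ≡-Reasoning
  E : ℕ
  E = ∑[ x < n ] count (λ y → does (x <? y) ∧ A x y)

record Biclique (s : ℕ) {n} (R : Adj n) : Set where
  field
    left right      : Fin s → Fin n
    left-injective  : Injective _≡_ _≡_ left
    right-injective : Injective _≡_ _≡_ right
    complete        : ∀ u v → R (left u) (right v) ≡ true

count*≤∑common : ∀ {n} (R : Adj n) (F : Fin n → Bool) {b} → (∀ {x} → F x ≡ true → b ≤ degree R x) →
                 count F * b ≤ ∑[ z < n ] count (λ x → F x ∧ R x z)
count*≤∑common {n} R F {b} high = begin
  count F * b                          ≡⟨ *-distribʳ-sum {n} b _ ⟩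
  ∑[ x < n ] (⟦ F x ⟧ * b)             ≤⟨ sum-mono-≤ pointwise ⟩
  ∑[ x < n ] count (λ z → F x ∧ R x z) ≡⟨ ∑-comm {n} {n} _ ⟩
  ∑[ z < n ] count (λ x → F x ∧ R x z) ∎
  where
  open ≤-Reasoning
  pointwise : ∀ x → ⟦ F x ⟧ * b ≤ count (λ z → F x ∧ R x z)
  pointwise x with F x in Fx
  ... | true  = ≤-trans (≤-reflexive (*-identityˡ b)) (high Fx)
  ... | false = z≤n

-- f (b − j) ≤ n c and n ≤ m (b − j) give f ≤ m c; stated without truncated subtraction.
excess-bound : ∀ {n f b j c} m .{{_ : NonZero n}} → n + m * j ≤ m * b → f * b ≤ n * c + f * j → f ≤ m * c
excess-bound {n} {f} {b} {j} {c} m gap excess =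
  *-cancelʳ-≤ f (m * c) n (+-cancelʳ-≤ (m * f * j) (f * n) (m * c * n) (begin
    f * n + m * f * j     ≡⟨ e₁ f n m j ⟩
    f * (n + m * j)       ≤⟨ *-monoʳ-≤ f gap ⟩
    f * (m * b)           ≡⟨ e₂ f m b ⟩
    m * (f * b)           ≤⟨ *-monoʳ-≤ m excess ⟩
    m * (n * c + f * j)   ≡⟨ e₃ m n c f j ⟩
    m * c * n + m * f * j ∎))
  where
  open ≤-Reasoning
  e₁ : ∀ f n m j → f * n + m * f * j ≡ f * (n + m * j)
  e₁ = solve-∀
  e₂ : ∀ f m b → f * (m * b) ≡ m * (f * b)
  e₂ = solve-∀
  e₃ : ∀ m n c f j → m * (n * c + f * j) ≡ m * c * n + m * f * j
  e₃ = solve-∀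

module CommonNeighbourhood {n} .{{_ : NonZero n}} (R : Adj n) {D b s : ℕ} .{{_ : NonZero D}}
                           (s<b : s < b) (spread : n + 2 * D * s ≤ 2 * D * b) where

  record Stage (j : ℕ) : Set where
    field
      Y            : Fin j → Fin n
      Y-injective  : Injective _≡_ _≡_ Y
      F            : Fin n → Bool
      F-common     : ∀ {x} → F x ≡ true → ∀ i → R x (Y i) ≡ true
      F-highDegree : ∀ {x} → F x ≡ true → b ≤ degree R x
      F-large      : n ≤ D * (2 * D) ^ j * count F

  initial : n ≤ D * count (highDegree R b) → Stage 0
  initial large = record
    { Y = [] ; Y-injective = λ { {()} } ; F = highDegree R b
    ; F-common = λ _ () ; F-highDegree = λ {x} → ⌊⌋≡true⇒ (b ≤? degree R x)
    ; F-large = ≤-trans large (≤-reflexive (cong (_* count (highDegree R b)) (sym (*-identityʳ D)))) }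

  -- Each x ∈ F has at least b neighbours, at most j of which lie in Y, so some z ∉ Y is adjacent
  -- to roughly a (b − j)/n ≥ 1/(2D) fraction of F.
  next : ∀ {j} → j < s → Stage j → Stage (suc j)
  next {j} j<s S = record
    { Y = z ∷ Y ; Y-injective = ∷-injective Y-injective z∉Y
    ; F = λ x → F x ∧ R x z
    ; F-common = λ F′x → λ { zero → ∧-conicalʳ _ _ F′x ; (suc i) → F-common (∧-conicalˡ _ _ F′x) i }
    ; F-highDegree = F-highDegree ∘ ∧-conicalˡ _ _
    ; F-large = ≤-trans F-large (≤-trans (*-monoʳ-≤ (D * (2 * D) ^ j) shrink)
                                         (≤-reflexive (regroup D ((2 * D) ^ j) (common z))))
    }
    where
    open Stage S
    open ≤-Reasoning

    common : Fin n → ℕ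
    common z = count (λ x → F x ∧ R x z)

    instance
      F-nonempty : NonZero (count F)
      F-nonempty = ≢-nonZero λ F≡0 → <⇒≱ (>-nonZero⁻¹ n)
        (≤-trans F-large (≤-reflexive (trans (cong (D * (2 * D) ^ j *_) F≡0) (*-zeroʳ (D * (2 * D) ^ j)))))

    few-masked : count F * count (inImage Y) < ∑[ z < n ] common z
    few-masked = begin-strict
      count F * count (inImage Y) ≤⟨ *-monoʳ-≤ (count F) (count-inImage≤ Y) ⟩
      count F * j                 <⟨ *-monoʳ-< (count F) (<-trans j<s s<b) ⟩
      count F * b                 ≤⟨ count*≤∑common R F F-highDegree ⟩
      ∑[ z < n ] common z         ∎

    heavy : ∃[ z ] (inImage Y z ≡ false × ∑[ z′ < n ] common z′ ≤ n * common z + count F * count (inImage Y))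
    heavy = ∃-heavy-outside common (inImage Y) (λ z → sum-mono-≤ λ x → ⟦∧⟧≤ (F x) (R x z)) few-masked

    z : Fin n
    z = proj₁ heavy

    z∉Y : inImage Y z ≡ false
    z∉Y = proj₁ (proj₂ heavy)

    shrink : count F ≤ 2 * D * common z
    shrink = excess-bound (2 * D) (≤-trans (+-monoʳ-≤ n (*-monoʳ-≤ (2 * D) (<⇒≤ j<s))) spread) (begin
      count F * b                                ≤⟨ count*≤∑common R F F-highDegree ⟩
      ∑[ z′ < n ] common z′                      ≤⟨ proj₂ (proj₂ heavy) ⟩
      n * common z + count F * count (inImage Y)
        ≤⟨ +-monoʳ-≤ (n * common z) (*-monoʳ-≤ (count F) (count-inImage≤ Y)) ⟩
      n * common z + count F * j                 ∎)

    regroup : ∀ D P c → D * P * (2 * D * c) ≡ D * (2 * D * P) * c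
    regroup = solve-∀

  stage : ∀ j → j ≤ s → Stage 0 → Stage j
  stage zero    _   S₀ = S₀
  stage (suc j) j<s S₀ = next j<s (stage j (<⇒≤ j<s) S₀)

  biclique : n ≤ D * count (highDegree R b) → D * (2 * D) ^ s * s ≤ n → Biclique s R
  biclique base large = record
    { left = proj₁ X ; right = Y
    ; left-injective = proj₁ (proj₂ X) ; right-injective = Y-injective
    ; complete = λ u v → F-common (proj₂ (proj₂ X) u) v }
    where
    open Stage (stage s ≤-refl (initial base))
    instance
      power≢0 : NonZero ((2 * D) ^ s)
      power≢0 = m^n≢0 (2 * D) s {{m*n≢0 2 D}}
      scale≢0 : NonZero (D * (2 * D) ^ s)
      scale≢0 = m*n≢0 D ((2 * D) ^ s)
    X : Σ (Fin s → Fin n) λ X → Injective _≡_ _≡_ X × (∀ u → F (X u) ≡ true)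
    X = injective-choice (λ _ → F) (λ _ → *-cancelˡ-≤ (D * (2 * D) ^ s) (≤-trans large F-large))

degreeSum≤ : ∀ {n} (R : Adj n) b → degreeSum R ≤ n * count (highDegree R b) + n * b
degreeSum≤ {n} R b = begin
  degreeSum R                                                 ≤⟨ sum-mono-≤ pointwise ⟩
  ∑[ x < n ] (n * ⟦ highDegree R b x ⟧ + b)                   ≡⟨ ∑-distrib-+ {n} _ _ ⟩
  ∑[ x < n ] (n * ⟦ highDegree R b x ⟧) + ∑[ x < n ] b
    ≡⟨ cong₂ _+_ (*-distribˡ-sum {n} n _) (sym (sum-const n b)) ⟨
  n * count (highDegree R b) + n * b                          ∎
  where
  open ≤-Reasoning
  pointwise : ∀ x → degree R x ≤ n * ⟦ highDegree R b x ⟧ + b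
  pointwise x with b ≤? degree R x
  ... | yes _  = ≤-trans (≤-trans (count≤size (R x)) (≤-reflexive (sym (*-identityʳ n)))) (m≤m+n (n * 1) b)
  ... | no b≰ = ≤-trans (<⇒≤ (≰⇒> b≰)) (m≤n+m b (n * 0))

manyHighDegree : ∀ {n Q} (R : Adj n) b → n * (n ∸ 1) < Q * degreeSum R → 4 * Q * b ≤ n →
                 n ≤ 4 * Q * count (highDegree R b)
manyHighDegree {n} {Q} R b dense few = ≤-trans (m≤m+n n (2 * n)) (+-cancelʳ-≤ n (n + 2 * n) (4 * Q * F) (begin
  n + 2 * n + n         ≡⟨ e₁ n ⟩
  4 * n                 ≤⟨ *-monoʳ-≤ 4 n≤ ⟩
  4 * (Q * F + Q * b)   ≡⟨ e₂ Q F b ⟩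
  4 * Q * F + 4 * Q * b ≤⟨ +-monoʳ-≤ (4 * Q * F) few ⟩
  4 * Q * F + n         ∎))
  where
  open ≤-Reasoning
  F : ℕ
  F = count (highDegree R b)
  e₀ : ∀ Q n F b → Q * (n * F + n * b) ≡ n * (Q * F + Q * b)
  e₀ = solve-∀
  e₁ : ∀ n → n + 2 * n + n ≡ 4 * n
  e₁ = solve-∀
  e₂ : ∀ Q F b → 4 * (Q * F + Q * b) ≡ 4 * Q * F + 4 * Q * b
  e₂ = solve-∀
  n≤ : n ≤ Q * F + Q * b
  n≤ = ≤-trans (m≤n+m∸n n 1) (*-cancelˡ-< n _ _
         (subst (n * (n ∸ 1) <_) (e₀ Q n F b) (<-≤-trans dense (*-monoʳ-≤ Q (degreeSum≤ R b)))))

threshold-bounds : ∀ n d s .{{_ : NonZero d}} → d * suc s ≤ n →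
                   n + d * s ≤ d * (n / d + suc s) × d * (n / d + suc s) ≤ 2 * n
threshold-bounds n d s large = spread , bounded
  where
  open ≤-Reasoning
  e₁ : ∀ a d s → suc a * d + d * s ≡ d * (a + suc s)
  e₁ = solve-∀
  e₂ : ∀ a d s → d * (a + suc s) ≡ a * d + d * suc s
  e₂ = solve-∀
  e₃ : ∀ n → n + n ≡ 2 * n
  e₃ = solve-∀
  spread : n + d * s ≤ d * (n / d + suc s)
  spread = begin
    n + d * s                 ≡⟨ cong (_+ d * s) (m≡m%n+[m/n]*n n d) ⟩
    n % d + n / d * d + d * s ≤⟨ +-monoˡ-≤ (d * s) (+-monoˡ-≤ (n / d * d) (<⇒≤ (m%n<n n d))) ⟩
    suc (n / d) * d + d * s   ≡⟨ e₁ (n / d) d s ⟩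
    d * (n / d + suc s)       ∎
  bounded : d * (n / d + suc s) ≤ 2 * n
  bounded = begin
    d * (n / d + suc s)       ≡⟨ e₂ (n / d) d s ⟩
    n / d * d + d * suc s     ≤⟨ +-mono-≤ (m/n*n≤m n d) large ⟩
    n + n                     ≡⟨ e₃ n ⟩
    2 * n                     ∎

-- The degree threshold b = ⌊n/2D⌋ + s + 1 is small enough for the high-degree vertices to make up a
-- 1/D fraction of all vertices, and large enough for each step to keep a 1/(2D) fraction of F.
dense⇒biclique : (s Q : ℕ) .{{_ : NonZero Q}} →
                 ∃[ N ] (∀ {n} → N ≤ n → (R : Adj n) → n * (n ∸ 1) < Q * degreeSum R → Biclique s R)
dense⇒biclique s Q = suc (2 * D * suc s + D * (2 * D) ^ s * s) , found
  where
  D : ℕ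
  D = 4 * Q
  found : ∀ {n} → suc (2 * D * suc s + D * (2 * D) ^ s * s) ≤ n → (R : Adj n) →
          n * (n ∸ 1) < Q * degreeSum R → Biclique s R
  found {n} N≤n R dense =
    CommonNeighbourhood.biclique R {D} {b} {s} (m≤n+m (suc s) (n / (2 * D))) (proj₁ bounds) base large
    where
    instance
      n≢0 : NonZero n
      n≢0 = >-nonZero (≤-trans (s≤s z≤n) N≤n)
      D≢0 : NonZero D
      D≢0 = m*n≢0 4 Q
      2D≢0 : NonZero (2 * D)
      2D≢0 = m*n≢0 2 D
    b : ℕ
    b = n / (2 * D) + suc s
    bounds : n + 2 * D * s ≤ 2 * D * b × 2 * D * b ≤ 2 * n
    bounds = threshold-bounds n (2 * D) s (≤-trans (m≤m+n _ _) (≤-trans (n≤1+n _) N≤n))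
    base : n ≤ D * count (highDegree R b)
    base = manyHighDegree {Q = Q} R b dense
             (*-cancelˡ-≤ 2 (≤-trans (≤-reflexive (sym (*-assoc 2 D b))) (proj₂ bounds)))
    large : D * (2 * D) ^ s * s ≤ n
    large = ≤-trans (m≤n+m _ (2 * D * suc s)) (≤-trans (n≤1+n _) N≤n)

multiplicity : ∀ {k n} → GraphSystem k n → Fin n → Fin n → ℕ
multiplicity G x y = count (λ i → G i x y)

rich : ∀ {k n} → ℕ → GraphSystem k n → Adj n
rich ℓ G x y = ⌊ ℓ ≤? multiplicity G x y ⌋

-- Summing the k strict inequalities leaves a surplus of k, which survives cancelling k².
averaged-surplus : ∀ {k Q L P T} → 1 ≤ k → k * suc ((L * Q + k) * P) ≤ k * Q * (L * P + k * T) → P < Q * T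
averaged-surplus {k} {Q} {L} {P} {T} k≥1 summed =
  *-cancelˡ-< (k * k) P (Q * T) (≤-trans (+-monoˡ-≤ (k * k * P) k≥1) surplus)
  where
  e₁ : ∀ k Q L P → k * suc ((L * Q + k) * P) ≡ k * L * Q * P + (k + k * k * P)
  e₁ = solve-∀
  e₂ : ∀ k Q L P T → k * Q * (L * P + k * T) ≡ k * L * Q * P + k * k * (Q * T)
  e₂ = solve-∀
  surplus : k + k * k * P ≤ k * k * (Q * T)
  surplus = +-cancelˡ-≤ (k * L * Q * P) _ _ (subst₂ _≤_ (e₁ k Q L P) (e₂ k Q L P T) summed)

module _ {k n} {G : GraphSystem k n} (simple : IsGraphSystem G) where

  multiplicity-diagonal : ∀ x → multiplicity G x x ≡ 0
  multiplicity-diagonal x =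
    trans (sum-cong-≗ (λ i → cong ⟦_⟧ (proj₂ (simple i) x))) (trans (sum-const k 0) (*-zeroʳ k))

  rich-simple : ∀ {ℓ} → 1 ≤ ℓ → IsSimpleGraph (rich ℓ G)
  rich-simple {ℓ} ℓ≥1 =
    (λ x y → cong (λ m → ⌊ ℓ ≤? m ⌋) (sum-cong-≗ λ i → cong ⟦_⟧ (proj₁ (simple i) x y))) ,
    (λ x → trans (cong (λ m → ⌊ ℓ ≤? m ⌋) (multiplicity-diagonal x))
                 (trans (isYes≗does (ℓ ≤? 0)) (dec-false (ℓ ≤? 0) (<⇒≱ ℓ≥1))))

  multiplicity≤ : ∀ ℓ x y → multiplicity G x y ≤ (ℓ ∸ 1) * ⟦ completeGraph x y ⟧ + k * ⟦ rich ℓ G x y ⟧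
  multiplicity≤ ℓ x y with x ≟ y
  ... | yes refl = ≤-trans (≤-reflexive (multiplicity-diagonal x)) z≤n
  ... | no _ with ℓ ≤? multiplicity G x y
  ...   | yes _   = ≤-trans (count≤size (λ i → G i x y))
                              (≤-trans (≤-reflexive (sym (*-identityʳ k))) (m≤n+m _ _))
  ...   | no ℓ≰m = ≤-trans (∸-monoˡ-≤ 1 (≰⇒> ℓ≰m))
                              (≤-trans (≤-reflexive (sym (*-identityʳ (ℓ ∸ 1)))) (m≤m+n _ _))

  ∑-degreeSum≤ : ∀ ℓ → ∑[ i < k ] degreeSum (G i) ≤ (ℓ ∸ 1) * (n * (n ∸ 1)) + k * degreeSum (rich ℓ G)
  ∑-degreeSum≤ ℓ = begin
    ∑[ i < k ] ∑[ x < n ] ∑[ y < n ] ⟦ G i x y ⟧ ≡⟨ ∑-comm {k} {n} _ ⟩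
    ∑[ x < n ] ∑[ i < k ] ∑[ y < n ] ⟦ G i x y ⟧ ≡⟨ sum-cong-≗ {n} (λ x → ∑-comm {k} {n} _) ⟩
    ∑[ x < n ] ∑[ y < n ] multiplicity G x y      ≤⟨ sum-mono-≤ (λ x → sum-mono-≤ (multiplicity≤ ℓ x)) ⟩
    ∑[ x < n ] ∑[ y < n ] ((ℓ ∸ 1) * ⟦ completeGraph x y ⟧ + k * ⟦ rich ℓ G x y ⟧)
      ≡⟨ trans (sum-cong-≗ {n} λ x → ∑-linear {n} (ℓ ∸ 1) k _ _) (∑-linear {n} (ℓ ∸ 1) k _ _) ⟩
    (ℓ ∸ 1) * degreeSum (completeGraph {n}) + k * degreeSum (rich ℓ G)
      ≡⟨ cong (λ t → (ℓ ∸ 1) * t + k * degreeSum (rich ℓ G)) (degreeSum-completeGraph n) ⟩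
    (ℓ ∸ 1) * (n * (n ∸ 1)) + k * degreeSum (rich ℓ G) ∎
    where open ≤-Reasoning

  rich-dense : ∀ {ℓ Q} → 1 ≤ k →
               (∀ i → ((ℓ ∸ 1) * Q + k) * (n * (n ∸ 1)) < 2 * k * Q * edgeCount (G i)) →
               n * (n ∸ 1) < Q * degreeSum (rich ℓ G)
  rich-dense {ℓ} {Q} k≥1 dense = averaged-surplus {L = ℓ ∸ 1} k≥1 (begin
    k * suc X                                                    ≡⟨ sum-const k (suc X) ⟨
    ∑[ i < k ] suc X                                             ≤⟨ sum-mono-≤ dense′ ⟩
    ∑[ i < k ] (k * Q * degreeSum (G i))                         ≡⟨ *-distribˡ-sum {k} (k * Q) _ ⟨
    k * Q * ∑[ i < k ] degreeSum (G i)                           ≤⟨ *-monoʳ-≤ (k * Q) (∑-degreeSum≤ ℓ) ⟩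
    k * Q * ((ℓ ∸ 1) * (n * (n ∸ 1)) + k * degreeSum (rich ℓ G)) ∎)
    where
    open ≤-Reasoning
    X : ℕ
    X = ((ℓ ∸ 1) * Q + k) * (n * (n ∸ 1))
    regroup : ∀ k Q e → 2 * k * Q * e ≡ k * Q * (2 * e)
    regroup = solve-∀
    dense′ : ∀ i → suc X ≤ k * Q * degreeSum (G i)
    dense′ i = ≤-trans (dense i)
      (≤-reflexive (trans (regroup k Q _) (cong (k * Q *_) (sym (handshake (G i) (simple i))))))

embed-bipartite : (H : Multigraph) → Bipartite H → ∀ {n} (R : Adj n) → IsSimpleGraph R → Biclique (nV H) R →
                  Σ (Fin (nV H) → Fin n) λ φ → Injective _≡_ _≡_ φ ×
                    (∀ e → R (φ (proj₁ (ends H e))) (φ (proj₂ (ends H e))) ≡ true)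
embed-bipartite H (colour , proper) {n} R (R-sym , R-irr) K =
  φ , (λ {u} {v} → side-injective (colour u) (colour v)) , λ e → side-edge _ _ (proper e)
  where
  open Biclique K
  side : Bool → Fin (nV H) → Fin n
  side true  = left
  side false = right

  φ : Fin (nV H) → Fin n
  φ v = side (colour v) v

  disjoint : ∀ u v → left u ≢ right v
  disjoint u v eq = contradiction
    (trans (sym (subst (λ x → R x (right v) ≡ true) eq (complete u v))) (R-irr (right v))) λ ()

  side-injective : ∀ a b {u v} → side a u ≡ side b v → u ≡ v
  side-injective true  true  eq = left-injective eq
  side-injective false false eq = right-injective eq
  side-injective true  false eq = contradiction eq (disjoint _ _)
  side-injective false true  eq = contradiction (sym eq) (disjoint _ _)

  side-edge : ∀ a b {u v} → a ≢ b → R (side a u) (side b v) ≡ true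
  side-edge true  false _   = complete _ _
  side-edge false true  _   = trans (R-sym _ _) (complete _ _)
  side-edge true  true  a≢b = contradiction refl a≢b
  side-edge false false a≢b = contradiction refl a≢b

rich-embedding⇒rainbowCopy : (H : Multigraph) {k n : ℕ} (G : GraphSystem k n) (φ : Fin (nV H) → Fin n) →
  Injective _≡_ _≡_ φ → (∀ e → rich (nE H) G (φ (proj₁ (ends H e))) (φ (proj₂ (ends H e))) ≡ true) →
  RainbowCopy H G
rich-embedding⇒rainbowCopy H G φ φ-injective rich-edges =
  let ψ , ψ-injective , ψ-edges = injective-choice (λ e i → G i (φ (proj₁ (ends H e))) (φ (proj₂ (ends H e))))
                                                   (λ e → ⌊⌋≡true⇒ (nE H ≤? _) (rich-edges e))
  in φ , ψ , φ-injective , ψ-injective , ψ-edges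

dense-system⇒rainbowCopy :
  (H : Multigraph) → Bipartite H → 1 ≤ nE H → ∀ {k} → nE H ≤ k → ∀ Q .{{_ : NonZero Q}} →
  ∃[ N ] (∀ {n} → N ≤ n → (G : GraphSystem k n) → IsGraphSystem G →
          (∀ i → ((nE H ∸ 1) * Q + k) * (n * (n ∸ 1)) < 2 * k * Q * edgeCount (G i)) →
          RainbowCopy H G)
dense-system⇒rainbowCopy H bipartite ℓ≥1 ℓ≤k Q =
  let N , biclique = dense⇒biclique (nV H) Q
  in N , λ N≤n G simple dense →
       let R = rich (nE H) G
           φ , φ-injective , φ-rich = embed-bipartite H bipartite R (rich-simple simple ℓ≥1)
                                        (biclique N≤n R (rich-dense simple (≤-trans ℓ≥1 ℓ≤k) dense))
       in rich-embedding⇒rainbowCopy H G φ φ-injective φ-rich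

proposition1p5 :
    (H : Multigraph) → Bipartite H → 1 ≤ nE H →
    (k : ℕ) → nE H ≤ k →
    (q : ℕ) →
    ∃[ N ] ((n : ℕ) → N ≤ n →
      (G : GraphSystem k n) → IsGraphSystem G → RainbowFree H G →
      ∃[ i ] (2 * k * suc q * edgeCount (G i)
              ≤ ((nE H ∸ 1) * suc q + k) * (n * (n ∸ 1))))
proposition1p5 H bipartite ℓ≥1 k ℓ≤k q =
  let N , copy = dense-system⇒rainbowCopy H bipartite ℓ≥1 ℓ≤k (suc q)
  in N , λ n N≤n G simple rainbowFree →
       decidable-stable (any? λ i → 2 * k * suc q * edgeCount (G i) ≤? ((nE H ∸ 1) * suc q + k) * (n * (n ∸ 1)))
         λ noneSparse → rainbowFree (copy N≤n G simple λ i → ≰⇒> (noneSparse ∘ (i ,_)))
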